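{- Let $n$ be the number of vertices of a vertex set $V$, let $\mathbf{W}=(S,A,B)$ be a triple of pairwise disjoint sets with $V=S\cup A\cup B$, and let $E_W$ be the set of unordered pairs of distinct vertices of $V$ other than the pairs $\{u,v\}$ with $u\in A$, $v\in B$. Let $\Omega=E_W^{\,m}$; each $\omega=(\omega_1,\dots,\omega_m)\in\Omega$ determines a multigraph $G_\omega$ on $V$ with edge multiset $\{\omega_1,\dots,\omega_m\}$. Let $d\ge 2$ be an integer and $\epsilon=\frac{1}{d-1}$. For $U\subseteq B$ with $1\le |U|\le d$, let $I_U(\omega)=1$ if $G_\omega[U]$ is a tree and no edge of $G_\omega$ joins $U$ to $B\setminus U$ (i.e. $G_\omega[U]$ is a tree component of $G_\omega[B]$), and $I_U(\omega)=0$ otherwise, and set $$I(\omega)=\sum_{U\subseteq B,\ 1\le|U|\le d}\big(1-(|U|-1)\epsilon\big)I_U(\omega).$$ Then for any $\omega,\omega'\in\Omega$ that differ in exactly one coordinate, $$|I(\omega)-I(\omega')|\leq 1+\epsilon.$$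
   Context: A multigraph on $U$ is a tree only if it has no parallel edges and no cycles; a single vertex with no edges counts as a tree. -}

module Defs where

open import Data.Nat as ℕ using (ℕ; zero; suc; _∸_)
open import Data.Fin using (Fin; _<_)
open import Data.Fin.Subset using (Subset; _∈_; _∉_; _⊆_; ∣_∣; inside; outside)
open import Data.Fin.Subset.Properties using (_⊆?_)
open import Data.Vec using (_∷_; [])
open import Data.List using (List; []; _∷_; map; _++_; filter; foldr)
open import Data.List.Relation.Unary.Unique.Propositional using (Unique)
open import Data.Product using (_×_; _,_; Σ; ∃; proj₁; proj₂)
open import Data.Sum using (_⊎_)
open import Data.Empty using (⊥)
open import Data.Integer using (+_)
open import Data.Rational using (ℚ; 0ℚ; 1ℚ; _/_; _+_; _-_; _*_)
open import Relation.Nullary using (¬_; Dec; _×-dec_)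
open import Relation.Binary.PropositionalEquality using (_≡_)

-- A raw edge is an ordered pair (u , v); an unordered pair {u,v} of distinct
-- vertices is encoded canonically by the pair with u < v.
Edge : ℕ → Set
Edge n = Fin n × Fin n

InEW : ∀ {n} → (A B : Subset n) → Edge n → Set
InEW A B (u , v) = (u < v) × ¬ (u ∈ A × v ∈ B) × ¬ (u ∈ B × v ∈ A)

-- An element of E_W^m (raw form; membership in E_W is a separate hypothesis).
Seq : ℕ → ℕ → Set
Seq m n = Fin m → Edge n

Ends : ∀ {m n} → Seq m n → Fin m → Fin n → Fin n → Set
Ends ω i x y = (ω i ≡ (x , y)) ⊎ (ω i ≡ (y , x))

Adj : ∀ {m n} → Seq m n → Subset n → Fin n → Fin n → Set
Adj ω U x y = x ∈ U × y ∈ U × ∃ λ i → Ends ω i x y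

data Reach {m n} (ω : Seq m n) (U : Subset n) : Fin n → Fin n → Set where
  here  : ∀ {x} → x ∈ U → Reach ω U x x
  step  : ∀ {x y z} → Adj ω U x y → Reach ω U y z → Reach ω U x z

data Path {m n} (ω : Seq m n) (U : Subset n) : List (Fin n) → Set where
  one  : ∀ {x} → Path ω U (x ∷ [])
  cons : ∀ {x y vs} → Adj ω U x y → Path ω U (y ∷ vs) → Path ω U (x ∷ y ∷ vs)

lastOf : ∀ {a} {X : Set a} → X → List X → X
lastOf x [] = x
lastOf x (y ∷ vs) = lastOf y vs

Cycle : ∀ {m n} → Seq m n → Subset n → List (Fin n) → Set
Cycle ω U [] = ⊥
Cycle ω U (x ∷ []) = ⊥
Cycle ω U (x ∷ y ∷ []) = ⊥
Cycle ω U (x ∷ y ∷ z ∷ vs) =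
  Unique (x ∷ y ∷ z ∷ vs) × Path ω U (x ∷ y ∷ z ∷ vs) × Adj ω U (lastOf z vs) x

ParallelEdges : ∀ {m n} → Seq m n → Subset n → Set
ParallelEdges {m} {n} ω U =
  Σ (Fin m) λ i → Σ (Fin m) λ j → ¬ (i ≡ j) ×
    Σ (Fin n) λ x → Σ (Fin n) λ y → x ∈ U × y ∈ U × Ends ω i x y × Ends ω j x y

IsTree : ∀ {m n} → Seq m n → Subset n → Set
IsTree {m} {n} ω U =
  (∃ λ x → x ∈ U)
  × (∀ x y → x ∈ U → y ∈ U → Reach ω U x y)
  × ¬ ParallelEdges ω U
  × (∀ vs → ¬ Cycle ω U vs)

TreeComponent : ∀ {m n} → Subset n → Seq m n → Subset n → Set
TreeComponent {m} {n} B ω U =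
  IsTree ω U × (∀ (i : Fin m) (x y : Fin n) → Ends ω i x y → x ∈ U → y ∈ B → y ∈ U)

IsIndicator : ∀ {m n} → Subset n → (Seq m n → Subset n → ℚ) → Set
IsIndicator B ind = ∀ ω U →
  (TreeComponent B ω U × ind ω U ≡ 1ℚ) ⊎ (¬ TreeComponent B ω U × ind ω U ≡ 0ℚ)

allSubsets : (n : ℕ) → List (Subset n)
allSubsets zero = [] ∷ []
allSubsets (suc n) = map (inside ∷_) (allSubsets n) ++ map (outside ∷_) (allSubsets n)

-- ε = 1/(d-1) (only used for d ≥ 2).
eps : ℕ → ℚ
eps (suc (suc k)) = (+ 1) / suc k
eps _ = 0ℚ

ℕtoℚ : ℕ → ℚ
ℕtoℚ k = (+ k) / 1

Admissible : ∀ {n} → Subset n → ℕ → Subset n → Set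
Admissible B d U = U ⊆ B × 1 ℕ.≤ ∣ U ∣ × ∣ U ∣ ℕ.≤ d

admissible? : ∀ {n} (B : Subset n) (d : ℕ) (U : Subset n) → Dec (Admissible B d U)
admissible? B d U = (U ⊆? B) ×-dec ((1 ℕ.≤? ∣ U ∣) ×-dec (∣ U ∣ ℕ.≤? d))

sumℚ : List ℚ → ℚ
sumℚ = foldr _+_ 0ℚ

Ifun : ∀ {m n} → Subset n → ℕ → (Seq m n → Subset n → ℚ) → Seq m n → ℚ
Ifun {m} {n} B d ind ω =
  sumℚ (map (λ U → (1ℚ - ℕtoℚ (∣ U ∣ ∸ 1) * eps d) * ind ω U)
            (filter (admissible? B d) (allSubsets n)))

module Submission where

-- Let H be ω with its edge j = {x, y} deleted; deleting edge j from ω′ gives the same H, so it is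
-- enough to show 0 ≤ I(H) - I(G) ≤ 1 + ε when G is H plus an edge {x, y} with x, y ∈ B (otherwise
-- nothing changes).  With w(t) = 1 - (t - 1) ε, only the admissible tree components meeting {x, y}
-- contribute to the difference: T₁ ∋ x and T₂ ∋ y, x ∉ T₂ in H, and T ∋ x, y in G, each possibly absent.
-- If T exists, the component of x in H[T] is a subtree T₁ ⊆ T, so w(|T₁|) ≥ w(|T|); if T₂ exists too,
-- then T = T₁ ∪ T₂ and the difference is exactly w(a) + w(b) - w(a + b) = 1 + ε.  If T is absent but
-- T₁ and T₂ exist, then T₁ ∪ T₂ is a tree component of G that is too large, |T₁| + |T₂| > d, which
-- forces w(|T₁|) + w(|T₂|) ≤ 1 + ε.

open import Defs
open import Data.Bool using (if_then_else_)
open import Function using (id)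
open import Data.Empty using (⊥; ⊥-elim)
open import Data.Fin using (Fin; zero; suc)
open import Data.Fin.Properties using (<⇒≢) renaming (_≟_ to _≟ᶠ_)
open import Data.Fin.Subset using (Subset; _∈_; _∉_; _⊆_; _∪_; inside; outside) renaming (∣_∣ to ∣_∣ₛ)
open import Data.Fin.Subset.Properties using (_∈?_; x∈p∪q⁻; x∈p∪q⁺; ⊆-antisym; p⊆q⇒∣p∣≤∣q∣; ∣p∣≤∣x∷p∣; p⊆p∪q; q⊆p∪q)
open import Data.Integer using (+_; +≤+)
import Data.Integer.Properties as ℤ
open import Data.List using (List; []; _∷_; map; filter)
open import Data.List.Membership.Propositional using () renaming (_∈_ to _∈ₗ_)
open import Data.List.Membership.Propositional.Properties using (∈-map⁺; ∈-map⁻; ∈-++⁺ˡ; ∈-++⁺ʳ; ∈-filter⁺; ∈-filter⁻)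
open import Data.List.Relation.Unary.All as All using (All)
open import Data.List.Relation.Unary.AllPairs using ([]; _∷_)
open import Data.List.Relation.Unary.Any using (here; there)
open import Data.List.Relation.Unary.Unique.Propositional using (Unique)
import Data.List.Relation.Unary.Unique.Propositional.Properties as Unique
open import Data.Nat using (ℕ; zero; suc; _∸_; z≤n; s≤s; _≤_; _<_) renaming (_+_ to _+ₙ_)
import Data.Nat.Properties as ℕ
open import Data.Nat.Coprimality using (1-coprimeTo) renaming (sym to coprime-sym)
open import Data.Product using (_×_; _,_; Σ; proj₁; proj₂)
open import Data.Rational using (ℚ; mkℚ; _/_; 0ℚ; 1ℚ; ∣_∣; _+_; _-_; _*_; -_; *≤*) renaming (_≤_ to _≤ℚ_)
import Data.Rational.Properties as ℚ
open import Data.Rational.Solver using (module +-*-Solver)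
open import Data.Sum using (_⊎_; inj₁; inj₂)
open import Data.Vec using (_∷_; []; tabulate) renaming (here to hereᵥ; there to thereᵥ)
open import Data.Vec.Functional using (updateAt)
open import Data.Vec.Functional.Properties using (updateAt-updates; updateAt-minimal)
open import Data.Vec.Properties using (lookup∘tabulate; lookup⇒[]=; []=⇒lookup)
open import Relation.Nullary using (¬_; Dec; yes; no; does; _×-dec_; _⊎-dec_; ¬?)
open import Relation.Nullary.Decidable using (¬¬-excluded-middle)
open import Relation.Binary.PropositionalEquality using (_≡_; _≢_; refl; sym; trans; cong; cong₂; subst; subst₂; module ≡-Reasoning)

-- Finite subsets

∈-allSubsets : ∀ {n} (U : Subset n) → U ∈ₗ allSubsets n
∈-allSubsets [] = here refl
∈-allSubsets {suc n} (inside ∷ U) = ∈-++⁺ˡ (∈-map⁺ (inside ∷_) (∈-allSubsets U))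
∈-allSubsets {suc n} (outside ∷ U) =
  ∈-++⁺ʳ (map (inside ∷_) (allSubsets n)) (∈-map⁺ (outside ∷_) (∈-allSubsets U))

allSubsets-unique : ∀ n → Unique (allSubsets n)
allSubsets-unique zero = All.[] ∷ []
allSubsets-unique (suc n) =
  Unique.++⁺ (Unique.map⁺ ∷-injectiveʳ (allSubsets-unique n)) (Unique.map⁺ ∷-injectiveʳ (allSubsets-unique n))
             disjoint
  where
  ∷-injectiveʳ : ∀ {b c} {p q : Subset n} → _≡_ {A = Subset (suc n)} (b ∷ p) (c ∷ q) → p ≡ q
  ∷-injectiveʳ refl = refl
  disjoint : ∀ {U} → U ∈ₗ map (inside ∷_) (allSubsets n) × U ∈ₗ map (outside ∷_) (allSubsets n) → ⊥
  disjoint (p , q) with ∈-map⁻ (inside ∷_) p | ∈-map⁻ (outside ∷_) q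
  ... | _ , _ , refl | _ , _ , ()

x∈p⇒0<∣p∣ : ∀ {n} {p : Subset n} {z} → z ∈ p → 0 < ∣ p ∣ₛ
x∈p⇒0<∣p∣ hereᵥ = s≤s z≤n
x∈p⇒0<∣p∣ {p = b ∷ p} (thereᵥ z∈p) = ℕ.≤-trans (x∈p⇒0<∣p∣ z∈p) (∣p∣≤∣x∷p∣ b p)

∣p∪q∣≡∣p∣+∣q∣ : ∀ {n} (p q : Subset n) → (∀ {z} → z ∈ p → z ∈ q → ⊥) → ∣ p ∪ q ∣ₛ ≡ ∣ p ∣ₛ +ₙ ∣ q ∣ₛ
∣p∪q∣≡∣p∣+∣q∣ [] [] _ = refl
∣p∪q∣≡∣p∣+∣q∣ (inside ∷ p) (inside ∷ q) disj = ⊥-elim (disj hereᵥ hereᵥ)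
∣p∪q∣≡∣p∣+∣q∣ (inside ∷ p) (outside ∷ q) disj =
  cong suc (∣p∪q∣≡∣p∣+∣q∣ p q (λ a b → disj (thereᵥ a) (thereᵥ b)))
∣p∪q∣≡∣p∣+∣q∣ (outside ∷ p) (inside ∷ q) disj =
  trans (cong suc (∣p∪q∣≡∣p∣+∣q∣ p q (λ a b → disj (thereᵥ a) (thereᵥ b)))) (sym (ℕ.+-suc _ _))
∣p∪q∣≡∣p∣+∣q∣ (outside ∷ p) (outside ∷ q) disj = ∣p∪q∣≡∣p∣+∣q∣ p q (λ a b → disj (thereᵥ a) (thereᵥ b))

module _ {n} {P : Fin n → Set} (P? : ∀ z → Dec (P z)) where

  subset : Subset n
  subset = tabulate (λ z → if does (P? z) then inside else outside)

  ∈-subset⁺ : ∀ {z} → P z → z ∈ subset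
  ∈-subset⁺ {z} pz = lookup⇒[]= z subset (trans (lookup∘tabulate _ z) (reduce (P? z)))
    where
    reduce : (d : Dec (P z)) → (if does d then inside else outside) ≡ inside
    reduce (yes _) = refl
    reduce (no ¬pz) = ⊥-elim (¬pz pz)

  ∈-subset⁻ : ∀ {z} → z ∈ subset → P z
  ∈-subset⁻ {z} z∈ = reduce (P? z) (trans (sym (lookup∘tabulate _ z)) ([]=⇒lookup z∈))
    where
    reduce : (d : Dec (P z)) → (if does d then inside else outside) ≡ inside → P z
    reduce (yes pz) _ = pz
    reduce (no _) ()

¬¬-decidable : ∀ {n} (P : Fin n → Set) → ¬ ¬ (∀ z → Dec (P z))
¬¬-decidable {zero} P k = k (λ ())
¬¬-decidable {suc n} P k = ¬¬-excluded-middle λ P0? →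
  ¬¬-decidable (λ z → P (suc z)) λ Ps? → k λ { zero → P0? ; (suc z) → Ps? z }

-- Sums of rationals over lists

module _ {A : Set} where

  sumℚ-cong : ∀ {f g : A → ℚ} (L : List A) → (∀ {U} → U ∈ₗ L → f U ≡ g U) →
    sumℚ (map f L) ≡ sumℚ (map g L)
  sumℚ-cong [] _ = refl
  sumℚ-cong (U ∷ L) f≡g = cong₂ _+_ (f≡g (here refl)) (sumℚ-cong L (λ U∈L → f≡g (there U∈L)))

  sumℚ-map-+ : ∀ (f g : A → ℚ) L → sumℚ (map (λ U → f U + g U) L) ≡ sumℚ (map f L) + sumℚ (map g L)
  sumℚ-map-+ f g [] = refl
  sumℚ-map-+ f g (U ∷ L) = trans (cong (λ s → f U + g U + s) (sumℚ-map-+ f g L))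
    (solve 4 (λ a b c d → (a :+ b) :+ (c :+ d) := (a :+ c) :+ (b :+ d)) refl (f U) (g U) _ _)
    where open +-*-Solver

  sumℚ-map-- : ∀ (f g : A → ℚ) L → sumℚ (map (λ U → f U - g U) L) ≡ sumℚ (map f L) - sumℚ (map g L)
  sumℚ-map-- f g [] = refl
  sumℚ-map-- f g (U ∷ L) = trans (cong (λ s → f U - g U + s) (sumℚ-map-- f g L))
    (solve 4 (λ a b c d → (a :- b) :+ (c :- d) := (a :+ c) :- (b :+ d)) refl (f U) (g U) _ _)
    where open +-*-Solver

select : ∀ {P : Set} → Dec P → ℚ → ℚ
select P? q = if does P? then q else 0ℚ

select-split : ∀ {TH TG X Y : Set} (TH? : Dec TH) (TG? : Dec TG) (X? : Dec X) (Y? : Dec Y) (c : ℚ) →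
  (¬ X → ¬ Y → TH → TG) → (¬ X → ¬ Y → TG → TH) →
  select TH? c - select TG? c ≡
  select (TH? ×-dec X?) c + select (TH? ×-dec (Y? ×-dec ¬? X?)) c - select (TG? ×-dec (X? ⊎-dec Y?)) c
select-split (yes _) (yes _) (yes _) (yes _) c _ _ = sym (cong (_- c) (ℚ.+-identityʳ c))
select-split (yes _) (yes _) (yes _) (no _) c _ _ = sym (cong (_- c) (ℚ.+-identityʳ c))
select-split (yes _) (yes _) (no _) (yes _) c _ _ = sym (cong (_- c) (ℚ.+-identityˡ c))
select-split (yes _) (yes _) (no _) (no _) c _ _ = ℚ.+-inverseʳ c
select-split (yes _) (no _) (yes _) (yes _) c _ _ = cong (_- 0ℚ) (sym (ℚ.+-identityʳ c))
select-split (yes _) (no _) (yes _) (no _) c _ _ = cong (_- 0ℚ) (sym (ℚ.+-identityʳ c))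
select-split (yes _) (no _) (no _) (yes _) c _ _ = cong (_- 0ℚ) (sym (ℚ.+-identityˡ c))
select-split (yes th) (no ¬tg) (no ¬x) (no ¬y) c H⇒G _ = ⊥-elim (¬tg (H⇒G ¬x ¬y th))
select-split (no _) (yes _) (yes _) (yes _) c _ _ = refl
select-split (no _) (yes _) (yes _) (no _) c _ _ = refl
select-split (no _) (yes _) (no _) (yes _) c _ _ = refl
select-split (no ¬th) (yes tg) (no ¬x) (no ¬y) c _ G⇒H = ⊥-elim (¬th (G⇒H ¬x ¬y tg))
select-split (no _) (no _) _ _ c _ _ = refl

data Selection {A : Set} (L : List A) (P : A → Set) (c : A → ℚ) : ℚ → Set where
  none : (∀ {U} → U ∈ₗ L → ¬ P U) → Selection L P c 0ℚ
  just : ∀ {U} → U ∈ₗ L → P U → Selection L P c (c U)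

module _ {A : Set} {P : A → Set} (P? : ∀ U → Dec (P U)) (c : A → ℚ) where

  selection : ∀ {L} → Unique L → (∀ {U U′} → U ∈ₗ L → U′ ∈ₗ L → P U → P U′ → U ≡ U′) →
    Selection L P c (sumℚ (map (λ U → select (P? U) (c U)) L))
  selection {[]} _ _ = none λ ()
  selection {U ∷ L} (U∉L ∷ unique) P-unique with P? U
  ... | yes PU = first (selection unique (λ p q → P-unique (there p) (there q)))
    where
    first : ∀ {s} → Selection L P c s → Selection (U ∷ L) P c (c U + s)
    first (none _) = subst (Selection (U ∷ L) P c) (sym (ℚ.+-identityʳ (c U))) (just (here refl) PU)
    first (just U′∈L PU′) = ⊥-elim (All.lookup U∉L U′∈L (P-unique (here refl) (there U′∈L) PU PU′))
  ... | no ¬PU = later (selection unique (λ p q → P-unique (there p) (there q)))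
    where
    later : ∀ {s} → Selection L P c s → Selection (U ∷ L) P c (0ℚ + s)
    later (none ¬P) = none λ { (here refl) → ¬PU ; (there U′∈L) → ¬P U′∈L }
    later (just U′∈L PU′) = subst (Selection (U ∷ L) P c) (sym (ℚ.+-identityˡ _)) (just (there U′∈L) PU′)

-- The weights 1 - (t - 1) ε

ℕtoℚ≡mkℚ : ∀ a → ℕtoℚ a ≡ mkℚ (+ a) 0 (coprime-sym (1-coprimeTo a))
ℕtoℚ≡mkℚ a = ℚ.↥p/↧p≡p (mkℚ (+ a) 0 (coprime-sym (1-coprimeTo a)))

ℕtoℚ-+ : ∀ a b → ℕtoℚ (a +ₙ b) ≡ ℕtoℚ a + ℕtoℚ b
ℕtoℚ-+ a b = trans (cong (_/ 1) (sym (cong₂ Data.Integer._+_ (ℤ.*-identityʳ (+ a)) (ℤ.*-identityʳ (+ b)))))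
  (sym (cong₂ _+_ (ℕtoℚ≡mkℚ a) (ℕtoℚ≡mkℚ b)))

ℕtoℚ-mono-≤ : ∀ {a b} → a ≤ b → ℕtoℚ a ≤ℚ ℕtoℚ b
ℕtoℚ-mono-≤ {a} {b} a≤b = subst₂ _≤ℚ_ (sym (ℕtoℚ≡mkℚ a)) (sym (ℕtoℚ≡mkℚ b))
  (*≤* (subst₂ Data.Integer._≤_ (sym (ℤ.*-identityʳ (+ a))) (sym (ℤ.*-identityʳ (+ b))) (+≤+ a≤b)))

p≤q⇒0≤q-p : ∀ {p q} → p ≤ℚ q → 0ℚ ≤ℚ q - p
p≤q⇒0≤q-p {p} {q} p≤q = subst (_≤ℚ q - p) (ℚ.+-inverseʳ p) (ℚ.+-monoˡ-≤ (- p) p≤q)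

0≤p⇒q-p≤q : ∀ {p q} → 0ℚ ≤ℚ p → q - p ≤ℚ q
0≤p⇒q-p≤q {p} {q} 0≤p = subst (q - p ≤ℚ_) (ℚ.+-identityʳ q) (ℚ.+-monoʳ-≤ q (ℚ.neg-antimono-≤ 0≤p))

∣p-q∣≤r : ∀ {h p q r} → 0ℚ ≤ℚ h - p → h - p ≤ℚ r → 0ℚ ≤ℚ h - q → h - q ≤ℚ r → ∣ p - q ∣ ≤ℚ r
∣p-q∣≤r {h} {p} {q} {r} 0≤h-p h-p≤r 0≤h-q h-q≤r with ℚ.∣p∣≡p∨∣p∣≡-p (p - q)
... | inj₁ ∣p-q∣≡p-q = subst (_≤ℚ r) (sym (trans ∣p-q∣≡p-q p-q≡)) (ℚ.≤-trans (0≤p⇒q-p≤q 0≤h-p) h-q≤r)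
  where
  open +-*-Solver
  p-q≡ : p - q ≡ (h - q) - (h - p)
  p-q≡ = solve 3 (λ p q h → p :- q := (h :- q) :- (h :- p)) refl p q h
... | inj₂ ∣p-q∣≡q-p = subst (_≤ℚ r) (sym (trans ∣p-q∣≡q-p q-p≡)) (ℚ.≤-trans (0≤p⇒q-p≤q 0≤h-q) h-p≤r)
  where
  open +-*-Solver
  q-p≡ : - (p - q) ≡ (h - p) - (h - q)
  q-p≡ = solve 3 (λ p q h → :- (p :- q) := (h :- p) :- (h :- q)) refl p q h

module Weights (k : ℕ) where

  d : ℕ
  d = suc (suc k)

  ε : ℚ
  ε = eps d

  weight : ℕ → ℚ
  weight t = 1ℚ - ℕtoℚ (t ∸ 1) * ε

  private
    ε≡1/[1+k] : ε ≡ mkℚ (+ 1) k (1-coprimeTo (suc k))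
    ε≡1/[1+k] = ℚ.↥p/↧p≡p (mkℚ (+ 1) k (1-coprimeTo (suc k)))

    0≤ε : 0ℚ ≤ℚ ε
    0≤ε = subst (0ℚ ≤ℚ_) (sym ε≡1/[1+k]) (ℚ.nonNegative⁻¹ (mkℚ (+ 1) k (1-coprimeTo (suc k))))

    [d-1]ε≡1 : ℕtoℚ (suc k) * ε ≡ 1ℚ
    [d-1]ε≡1 = trans (cong₂ _*_ (ℕtoℚ≡mkℚ (suc k)) ε≡1/[1+k])
      (ℚ.*-inverseʳ (mkℚ (+ suc k) 0 (coprime-sym (1-coprimeTo (suc k)))))

    *ε-mono-≤ : ∀ {p q} → p ≤ℚ q → p * ε ≤ℚ q * ε
    *ε-mono-≤ {p} {q} p≤q = subst (λ e → p * e ≤ℚ q * e) (sym ε≡1/[1+k])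
      (ℚ.*-monoʳ-≤-nonNeg (mkℚ (+ 1) k (1-coprimeTo (suc k))) p≤q)

    [t-1]ε-mono-≤ : ∀ {a t} → a ≤ t → ℕtoℚ (a ∸ 1) * ε ≤ℚ ℕtoℚ (t ∸ 1) * ε
    [t-1]ε-mono-≤ a≤t = *ε-mono-≤ (ℕtoℚ-mono-≤ (ℕ.∸-monoˡ-≤ 1 a≤t))

    1≤1+ε : 1ℚ ≤ℚ 1ℚ + ε
    1≤1+ε = subst (_≤ℚ 1ℚ + ε) (ℚ.+-identityʳ 1ℚ) (ℚ.+-monoʳ-≤ 1ℚ 0≤ε)

  0≤1+ε : 0ℚ ≤ℚ 1ℚ + ε
  0≤1+ε = ℚ.≤-trans (ℚ.nonNegative⁻¹ 1ℚ) 1≤1+ε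

  weight-nonneg : ∀ {t} → t ≤ d → 0ℚ ≤ℚ weight t
  weight-nonneg {t} t≤d = p≤q⇒0≤q-p (subst (ℕtoℚ (t ∸ 1) * ε ≤ℚ_) [d-1]ε≡1 ([t-1]ε-mono-≤ t≤d))

  weight≤1+ε : ∀ t → weight t ≤ℚ 1ℚ + ε
  weight≤1+ε t = ℚ.≤-trans (0≤p⇒q-p≤q 0≤[t-1]ε) 1≤1+ε
    where
    0≤[t-1]ε : 0ℚ ≤ℚ ℕtoℚ (t ∸ 1) * ε
    0≤[t-1]ε = subst (_≤ℚ ℕtoℚ (t ∸ 1) * ε) (ℚ.*-zeroˡ ε) (*ε-mono-≤ (ℕtoℚ-mono-≤ {b = t ∸ 1} z≤n))

  weight-split : ∀ {a b} → 0 < a → 0 < b → weight a + weight b - weight (a +ₙ b) ≡ 1ℚ + ε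
  weight-split {suc a} {suc b} _ _ = trans (cong (λ t → weight (suc a) + weight (suc b) - (1ℚ - t * ε)) a+1+b)
    (solve 3 (λ A B E → (con 1ℚ :- A :* E) :+ (con 1ℚ :- B :* E) :- (con 1ℚ :- (A :+ (con 1ℚ :+ B)) :* E)
                        := con 1ℚ :+ E)
           refl (ℕtoℚ a) (ℕtoℚ b) ε)
    where
    open +-*-Solver
    a+1+b : ℕtoℚ (a +ₙ suc b) ≡ ℕtoℚ a + (1ℚ + ℕtoℚ b)
    a+1+b = trans (ℕtoℚ-+ a (suc b)) (cong (λ s → ℕtoℚ a + s) (ℕtoℚ-+ 1 b))

  weight-antitone : ∀ {a t} → a ≤ t → t ≤ d → 0ℚ ≤ℚ weight a - weight t × weight a - weight t ≤ℚ 1ℚ + ε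
  weight-antitone {a} {t} a≤t t≤d =
    subst (0ℚ ≤ℚ_) difference (p≤q⇒0≤q-p ([t-1]ε-mono-≤ a≤t)) ,
    ℚ.≤-trans (0≤p⇒q-p≤q (weight-nonneg t≤d)) (weight≤1+ε a)
    where
    open +-*-Solver
    difference : ℕtoℚ (t ∸ 1) * ε - ℕtoℚ (a ∸ 1) * ε ≡ weight a - weight t
    difference = solve 3 (λ A T E → T :* E :- A :* E := (con 1ℚ :- A :* E) :- (con 1ℚ :- T :* E))
                       refl (ℕtoℚ (a ∸ 1)) (ℕtoℚ (t ∸ 1)) ε

  weight-+-large : ∀ {a b} → 0 < a → 0 < b → d ≤ a +ₙ b → weight a + weight b ≤ℚ 1ℚ + ε
  weight-+-large {suc a} {suc b} _ _ d≤a+b =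
    subst₂ _≤ℚ_ lhs rhs (ℚ.+-monoʳ-≤ (1ℚ + 1ℚ) (ℚ.neg-antimono-≤ (*ε-mono-≤ (ℕtoℚ-mono-≤ k≤a+b))))
    where
    open +-*-Solver
    k≤a+b : k ≤ a +ₙ b
    k≤a+b = ℕ.≤-pred (ℕ.≤-trans (ℕ.≤-pred d≤a+b) (ℕ.≤-reflexive (ℕ.+-suc a b)))
    lhs : 1ℚ + 1ℚ - ℕtoℚ (a +ₙ b) * ε ≡ weight (suc a) + weight (suc b)
    lhs = trans (cong (λ t → 1ℚ + 1ℚ - t * ε) (ℕtoℚ-+ a b))
      (solve 3 (λ A B E → con 1ℚ :+ con 1ℚ :- (A :+ B) :* E := (con 1ℚ :- A :* E) :+ (con 1ℚ :- B :* E))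
             refl (ℕtoℚ a) (ℕtoℚ b) ε)
    rhs : 1ℚ + 1ℚ - ℕtoℚ k * ε ≡ 1ℚ + ε
    rhs = trans (cong (λ t → 1ℚ + t - ℕtoℚ k * ε) (trans (sym [d-1]ε≡1) (cong (_* ε) (ℕtoℚ-+ 1 k))))
      (solve 2 (λ K E → con 1ℚ :+ (con 1ℚ :+ K) :* E :- K :* E := con 1ℚ :+ E) refl (ℕtoℚ k) ε)

-- Walks and tree components

Closed : ∀ {m n} → Subset n → Seq m n → Subset n → Set
Closed {m} {n} B ω U = ∀ (i : Fin m) (a b : Fin n) → Ends ω i a b → a ∈ U → b ∈ B → b ∈ U

module _ {m n} {B : Subset n} {ω : Seq m n} {U : Subset n} (t : TreeComponent B ω U) where

  component-connected : ∀ a b → a ∈ U → b ∈ U → Reach ω U a b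
  component-connected = proj₁ (proj₂ (proj₁ t))

  component-noParallel : ¬ ParallelEdges ω U
  component-noParallel = proj₁ (proj₂ (proj₂ (proj₁ t)))

  component-acyclic : ∀ zs → ¬ Cycle ω U zs
  component-acyclic = proj₂ (proj₂ (proj₂ (proj₁ t)))

lastOf-∈ : ∀ {A : Set} (z : A) zs → lastOf z zs ∈ₗ z ∷ zs
lastOf-∈ z [] = here refl
lastOf-∈ z (w ∷ zs) = there (lastOf-∈ w zs)

module _ {m n} {ω : Seq m n} where

  Ends-sym : ∀ {i a b} → Ends ω i a b → Ends ω i b a
  Ends-sym (inj₁ e) = inj₂ e
  Ends-sym (inj₂ e) = inj₁ e

  Adj-sym : ∀ {U a b} → Adj ω U a b → Adj ω U b a
  Adj-sym (a∈U , b∈U , i , e) = b∈U , a∈U , i , Ends-sym e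

  Reach-target : ∀ {U a b} → Reach ω U a b → b ∈ U
  Reach-target (here b∈U) = b∈U
  Reach-target (step _ r) = Reach-target r

  Reach-trans : ∀ {U a b c} → Reach ω U a b → Reach ω U b c → Reach ω U a c
  Reach-trans (here _) r = r
  Reach-trans (step adj r) r′ = step adj (Reach-trans r r′)

  Reach-∷ʳ : ∀ {U a b c} → Reach ω U a b → Adj ω U b c → Reach ω U a c
  Reach-∷ʳ r adj = Reach-trans r (step adj (here (proj₁ (proj₂ adj))))

  Reach-sym : ∀ {U a b} → Reach ω U a b → Reach ω U b a
  Reach-sym (here a∈U) = here a∈U
  Reach-sym (step adj r) = Reach-∷ʳ (Reach-sym r) (Adj-sym adj)

  Reach-closed : ∀ {B U V a b} → U ⊆ B → Closed B ω V → Reach ω U a b → a ∈ V → b ∈ V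
  Reach-closed U⊆B closed (here _) a∈V = a∈V
  Reach-closed U⊆B closed (step (_ , c∈U , i , e) r) a∈V =
    Reach-closed U⊆B closed r (closed i _ _ e a∈V (U⊆B c∈U))

  module _ {B : Subset n} where

    TreeComponent-⊆ : ∀ {U V z} → TreeComponent B ω U → U ⊆ B → Closed B ω V → z ∈ U → z ∈ V → U ⊆ V
    TreeComponent-⊆ ((_ , connected , _) , _) U⊆B closed z∈U z∈V w∈U =
      Reach-closed U⊆B closed (connected _ _ z∈U w∈U) z∈V

    TreeComponent-unique : ∀ {U V z} → TreeComponent B ω U → U ⊆ B → TreeComponent B ω V → V ⊆ B →
      z ∈ U → z ∈ V → U ≡ V
    TreeComponent-unique tU U⊆B tV V⊆B z∈U z∈V =
      ⊆-antisym (TreeComponent-⊆ tU U⊆B (proj₂ tV) z∈U z∈V) (TreeComponent-⊆ tV V⊆B (proj₂ tU) z∈V z∈U)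

-- H is G with edge j = {x, y} replaced by a loop at v, which amounts to deleting it: a loop lies on
-- no cycle, since cycles repeat no vertex, and is parallel to no edge, since G is loopless.

module EdgeDeletion {m n} {G H : Seq m n} {j : Fin m} {v : Fin n}
  (H≗G : ∀ i → i ≢ j → H i ≡ G i) (H-loop : H j ≡ (v , v))
  (loopless : ∀ i → proj₁ (G i) ≢ proj₂ (G i)) where

  x y : Fin n
  x = proj₁ (G j)
  y = proj₂ (G j)

  JoinsXY : Fin n → Fin n → Set
  JoinsXY a b = (a ≡ x × b ≡ y) ⊎ (a ≡ y × b ≡ x)

  Ends-H : ∀ {i a b} → Ends H i a b → (i ≡ j × a ≡ v × b ≡ v) ⊎ (i ≢ j × Ends G i a b)
  Ends-H {i} e with i ≟ᶠ j
  Ends-H (inj₁ e) | yes refl with trans (sym H-loop) e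
  ... | refl = inj₁ (refl , refl , refl)
  Ends-H (inj₂ e) | yes refl with trans (sym H-loop) e
  ... | refl = inj₁ (refl , refl , refl)
  Ends-H {i} (inj₁ e) | no i≢j = inj₂ (i≢j , inj₁ (trans (sym (H≗G i i≢j)) e))
  Ends-H {i} (inj₂ e) | no i≢j = inj₂ (i≢j , inj₂ (trans (sym (H≗G i i≢j)) e))

  Ends-G : ∀ {i a b} → Ends G i a b → (i ≡ j × JoinsXY a b) ⊎ (i ≢ j × Ends H i a b)
  Ends-G {i} e with i ≟ᶠ j
  Ends-G (inj₁ e) | yes refl = inj₁ (refl , inj₁ (sym (cong proj₁ e) , sym (cong proj₂ e)))
  Ends-G (inj₂ e) | yes refl = inj₁ (refl , inj₂ (sym (cong proj₂ e) , sym (cong proj₁ e)))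
  Ends-G {i} (inj₁ e) | no i≢j = inj₂ (i≢j , inj₁ (trans (H≗G i i≢j) e))
  Ends-G {i} (inj₂ e) | no i≢j = inj₂ (i≢j , inj₂ (trans (H≗G i i≢j) e))

  Ends-G-loop : ∀ {i a} → ¬ Ends G i a a
  Ends-G-loop {i} (inj₁ e) = loopless i (trans (cong proj₁ e) (sym (cong proj₂ e)))
  Ends-G-loop {i} (inj₂ e) = loopless i (trans (cong proj₁ e) (sym (cong proj₂ e)))

  x≢y : x ≢ y
  x≢y = loopless j

  Adj-H⇒G : ∀ {U U′ a b} → U ⊆ U′ → a ≢ b → Adj H U a b → Adj G U′ a b
  Adj-H⇒G U⊆U′ a≢b (a∈U , b∈U , i , e) with Ends-H e
  ... | inj₁ (_ , refl , refl) = ⊥-elim (a≢b refl)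
  ... | inj₂ (_ , e′) = U⊆U′ a∈U , U⊆U′ b∈U , i , e′

  Adj-G⇒H : ∀ {U a b} → ¬ (x ∈ U × y ∈ U) → Adj G U a b → Adj H U a b
  Adj-G⇒H xy∉U (a∈U , b∈U , i , e) with Ends-G e
  ... | inj₁ (_ , inj₁ (refl , refl)) = ⊥-elim (xy∉U (a∈U , b∈U))
  ... | inj₁ (_ , inj₂ (refl , refl)) = ⊥-elim (xy∉U (b∈U , a∈U))
  ... | inj₂ (_ , e′) = a∈U , b∈U , i , e′

  Reach-H⇒G : ∀ {U U′ a b} → U ⊆ U′ → Reach H U a b → Reach G U′ a b
  Reach-H⇒G U⊆U′ (here a∈U) = here (U⊆U′ a∈U)
  Reach-H⇒G U⊆U′ (step (a∈U , c∈U , i , e) r) with Ends-H e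
  ... | inj₁ (_ , refl , refl) = Reach-H⇒G U⊆U′ r
  ... | inj₂ (_ , e′) = step (U⊆U′ a∈U , U⊆U′ c∈U , i , e′) (Reach-H⇒G U⊆U′ r)

  Reach-G⇒H : ∀ {U a b} → ¬ (x ∈ U × y ∈ U) → Reach G U a b → Reach H U a b
  Reach-G⇒H xy∉U (here a∈U) = here a∈U
  Reach-G⇒H xy∉U (step adj r) = step (Adj-G⇒H xy∉U adj) (Reach-G⇒H xy∉U r)

  Path-H⇒G : ∀ {U U′ zs} → U ⊆ U′ → Unique zs → Path H U zs → Path G U′ zs
  Path-H⇒G U⊆U′ _ one = one
  Path-H⇒G U⊆U′ ((a≢b All.∷ _) ∷ unique) (cons adj p) = cons (Adj-H⇒G U⊆U′ a≢b adj) (Path-H⇒G U⊆U′ unique p)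

  Path-G⇒H : ∀ {U zs} → ¬ (x ∈ U × y ∈ U) → Path G U zs → Path H U zs
  Path-G⇒H xy∉U one = one
  Path-G⇒H xy∉U (cons adj p) = cons (Adj-G⇒H xy∉U adj) (Path-G⇒H xy∉U p)

  Cycle-H⇒G : ∀ {U U′ zs} → U ⊆ U′ → Cycle H U zs → Cycle G U′ zs
  Cycle-H⇒G {zs = a ∷ b ∷ c ∷ zs} U⊆U′ (unique@(a∉ ∷ _) , p , adj) =
    unique , Path-H⇒G U⊆U′ unique p ,
    Adj-H⇒G U⊆U′ (λ eq → All.lookup a∉ (there (lastOf-∈ c zs)) (sym eq)) adj

  Cycle-G⇒H : ∀ {U zs} → ¬ (x ∈ U × y ∈ U) → Cycle G U zs → Cycle H U zs
  Cycle-G⇒H {zs = a ∷ b ∷ c ∷ zs} xy∉U (unique , p , adj) = unique , Path-G⇒H xy∉U p , Adj-G⇒H xy∉U adj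

  ParallelEdges-H⇒G : ∀ {U U′} → U ⊆ U′ → ParallelEdges H U → ParallelEdges G U′
  ParallelEdges-H⇒G U⊆U′ (i , i′ , i≢i′ , a , b , a∈U , b∈U , e , e′) with Ends-H e | Ends-H e′
  ... | inj₁ (refl , refl , refl) | inj₁ (refl , _) = ⊥-elim (i≢i′ refl)
  ... | inj₁ (refl , refl , refl) | inj₂ (_ , f) = ⊥-elim (Ends-G-loop f)
  ... | inj₂ (_ , f) | inj₁ (refl , refl , refl) = ⊥-elim (Ends-G-loop f)
  ... | inj₂ (_ , f) | inj₂ (_ , f′) = i , i′ , i≢i′ , a , b , U⊆U′ a∈U , U⊆U′ b∈U , f , f′

  ParallelEdges-G⇒H : ∀ {U} → ¬ (x ∈ U × y ∈ U) → ParallelEdges G U → ParallelEdges H U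
  ParallelEdges-G⇒H xy∉U (i , i′ , i≢i′ , a , b , a∈U , b∈U , e , e′) with Ends-G e | Ends-G e′
  ... | inj₁ (_ , inj₁ (refl , refl)) | _ = ⊥-elim (xy∉U (a∈U , b∈U))
  ... | inj₁ (_ , inj₂ (refl , refl)) | _ = ⊥-elim (xy∉U (b∈U , a∈U))
  ... | inj₂ _ | inj₁ (_ , inj₁ (refl , refl)) = ⊥-elim (xy∉U (a∈U , b∈U))
  ... | inj₂ _ | inj₁ (_ , inj₂ (refl , refl)) = ⊥-elim (xy∉U (b∈U , a∈U))
  ... | inj₂ (_ , f) | inj₂ (_ , f′) = i , i′ , i≢i′ , a , b , a∈U , b∈U , f , f′

  module _ {B : Subset n} where

    Closed-G⇒H : ∀ {U} → Closed B G U → Closed B H U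
    Closed-G⇒H closed i a b e a∈U b∈B with Ends-H e
    ... | inj₁ (_ , refl , refl) = a∈U
    ... | inj₂ (_ , e′) = closed i a b e′ a∈U b∈B

    Closed-∪ : ∀ {T₁ T₂} → Closed B H T₁ → Closed B H T₂ → x ∈ T₁ → y ∈ T₂ → Closed B G (T₁ ∪ T₂)
    Closed-∪ {T₁} {T₂} closed₁ closed₂ x∈T₁ y∈T₂ i a b e a∈T b∈B with Ends-G e
    ... | inj₁ (_ , inj₁ (_ , refl)) = x∈p∪q⁺ (inj₂ y∈T₂)
    ... | inj₁ (_ , inj₂ (_ , refl)) = x∈p∪q⁺ (inj₁ x∈T₁)
    ... | inj₂ (_ , e′) with x∈p∪q⁻ T₁ T₂ a∈T
    ...   | inj₁ a∈T₁ = x∈p∪q⁺ (inj₁ (closed₁ i a b e′ a∈T₁ b∈B))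
    ...   | inj₂ a∈T₂ = x∈p∪q⁺ (inj₂ (closed₂ i a b e′ a∈T₂ b∈B))

    Closed-∋x⇔∋y : ∀ {T} → x ∈ B → y ∈ B → Closed B G T → x ∈ T ⊎ y ∈ T → x ∈ T × y ∈ T
    Closed-∋x⇔∋y x∈B y∈B closed (inj₁ x∈T) = x∈T , closed j x y (inj₁ refl) x∈T y∈B
    Closed-∋x⇔∋y x∈B y∈B closed (inj₂ y∈T) = closed j y x (inj₂ refl) y∈T x∈B , y∈T

    Avoids : Subset n → Set
    Avoids U = ¬ (x ∈ U × y ∈ B) × ¬ (y ∈ U × x ∈ B)

    TreeComponent-G⇒H : ∀ {U} → U ⊆ B → Avoids U → TreeComponent B G U → TreeComponent B H U
    TreeComponent-G⇒H {U} U⊆B (x↛B , _) ((nonempty , connected , noParallel , acyclic) , closed) =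
      (nonempty , (λ a b a∈U b∈U → Reach-G⇒H xy∉U (connected a b a∈U b∈U))
                , (λ par → noParallel (ParallelEdges-H⇒G id par))
                , (λ zs cyc → acyclic zs (Cycle-H⇒G id cyc)))
      , Closed-G⇒H closed
      where
      xy∉U : ¬ (x ∈ U × y ∈ U)
      xy∉U (x∈U , y∈U) = x↛B (x∈U , U⊆B y∈U)

    TreeComponent-H⇒G : ∀ {U} → U ⊆ B → Avoids U → TreeComponent B H U → TreeComponent B G U
    TreeComponent-H⇒G {U} U⊆B (x↛B , y↛B) ((nonempty , connected , noParallel , acyclic) , closed) =
      (nonempty , (λ a b a∈U b∈U → Reach-H⇒G id (connected a b a∈U b∈U))
                , (λ par → noParallel (ParallelEdges-G⇒H xy∉U par))
                , (λ zs cyc → acyclic zs (Cycle-G⇒H xy∉U cyc)))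
      , closedG
      where
      xy∉U : ¬ (x ∈ U × y ∈ U)
      xy∉U (x∈U , y∈U) = x↛B (x∈U , U⊆B y∈U)
      closedG : Closed B G U
      closedG i a b e a∈U b∈B with Ends-G e
      ... | inj₁ (_ , inj₁ (refl , refl)) = ⊥-elim (x↛B (a∈U , b∈B))
      ... | inj₁ (_ , inj₂ (refl , refl)) = ⊥-elim (y↛B (a∈U , b∈B))
      ... | inj₂ (_ , e′) = closed i a b e′ a∈U b∈B

    H-component⊆G-component : ∀ {T₁ T a} → TreeComponent B H T₁ → T₁ ⊆ B → Closed B G T →
      a ∈ T₁ → a ∈ T → T₁ ⊆ T
    H-component⊆G-component ((_ , connected , _) , _) T₁⊆B closed a∈T₁ a∈T z∈T₁ =
      Reach-closed T₁⊆B closed (Reach-H⇒G id (connected _ _ a∈T₁ z∈T₁)) a∈T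

    -- T₁ is the set of vertices reachable from x in H[T], under double negation since that
    -- reachability is not decided
    H-component-at-x : ∀ {T} → TreeComponent B G T → T ⊆ B → x ∈ T →
      ¬ ¬ (Σ (Subset n) λ T₁ → TreeComponent B H T₁ × T₁ ⊆ T × x ∈ T₁)
    H-component-at-x {T} ((_ , _ , noParallel , acyclic) , closed) T⊆B x∈T ¬component =
      ¬¬-decidable (Reach H T x) λ reach? → ¬component (component reach?)
      where
      component : (∀ z → Dec (Reach H T x z)) → Σ (Subset n) λ T₁ → TreeComponent B H T₁ × T₁ ⊆ T × x ∈ T₁
      component reach? = T₁ , (((x , x∈T₁) , connected , noParallel₁ , acyclic₁) , closed₁) , T₁⊆T , x∈T₁
        where
        T₁ : Subset n
        T₁ = subset reach?
        T₁⊆T : T₁ ⊆ T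
        T₁⊆T z∈T₁ = Reach-target (∈-subset⁻ reach? z∈T₁)
        x∈T₁ : x ∈ T₁
        x∈T₁ = ∈-subset⁺ reach? (here x∈T)
        restrict : ∀ {a z} → Reach H T x a → Reach H T a z → Reach H T₁ a z
        restrict x↝a (here _) = here (∈-subset⁺ reach? x↝a)
        restrict x↝a (step adj@(_ , _ , i , e) r) =
          step (∈-subset⁺ reach? x↝a , ∈-subset⁺ reach? (Reach-∷ʳ x↝a adj) , i , e)
               (restrict (Reach-∷ʳ x↝a adj) r)
        from-x : ∀ {z} → z ∈ T₁ → Reach H T₁ x z
        from-x z∈T₁ = restrict (here x∈T) (∈-subset⁻ reach? z∈T₁)
        connected : ∀ a b → a ∈ T₁ → b ∈ T₁ → Reach H T₁ a b
        connected a b a∈T₁ b∈T₁ = Reach-trans (Reach-sym (from-x a∈T₁)) (from-x b∈T₁)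
        noParallel₁ : ¬ ParallelEdges H T₁
        noParallel₁ par = noParallel (ParallelEdges-H⇒G T₁⊆T par)
        acyclic₁ : ∀ zs → ¬ Cycle H T₁ zs
        acyclic₁ zs cyc = acyclic zs (Cycle-H⇒G T₁⊆T cyc)
        closed₁ : Closed B H T₁
        closed₁ i a b e a∈T₁ b∈B = ∈-subset⁺ reach? (Reach-∷ʳ (∈-subset⁻ reach? a∈T₁)
          (T₁⊆T a∈T₁ , Closed-G⇒H closed i a b e (T₁⊆T a∈T₁) b∈B , i , e))

    module Merge {T₁ T₂} (tree₁ : TreeComponent B H T₁) (tree₂ : TreeComponent B H T₂)
      (T₁⊆B : T₁ ⊆ B) (T₂⊆B : T₂ ⊆ B) (x∈T₁ : x ∈ T₁) (y∈T₂ : y ∈ T₂) (x∉T₂ : x ∉ T₂) where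

      U : Subset n
      U = T₁ ∪ T₂

      disjoint : ∀ {z} → z ∈ T₁ → z ∈ T₂ → ⊥
      disjoint z∈T₁ z∈T₂ = x∉T₂ (TreeComponent-⊆ tree₁ T₁⊆B (proj₂ tree₂) z∈T₁ z∈T₂ x∈T₁)

      U⊆B : U ⊆ B
      U⊆B z∈U with x∈p∪q⁻ T₁ T₂ z∈U
      ... | inj₁ z∈T₁ = T₁⊆B z∈T₁
      ... | inj₂ z∈T₂ = T₂⊆B z∈T₂

      closed₁ : Closed B H T₁
      closed₁ = proj₂ tree₁

      closed₂ : Closed B H T₂
      closed₂ = proj₂ tree₂

      connected : ∀ a b → a ∈ U → b ∈ U → Reach G U a b
      connected a b a∈U b∈U = Reach-trans (to-x a∈U) (Reach-sym (to-x b∈U))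
        where
        to-x : ∀ {a} → a ∈ U → Reach G U a x
        to-x {a} a∈U with x∈p∪q⁻ T₁ T₂ a∈U
        ... | inj₁ a∈T₁ = Reach-H⇒G (p⊆p∪q T₂) (component-connected tree₁ a x a∈T₁ x∈T₁)
        ... | inj₂ a∈T₂ = Reach-∷ʳ (Reach-H⇒G (q⊆p∪q T₁ T₂) (component-connected tree₂ a y a∈T₂ y∈T₂))
                                   (x∈p∪q⁺ (inj₂ y∈T₂) , x∈p∪q⁺ (inj₁ x∈T₁) , j , inj₂ refl)

      no-H-edge-xy : ∀ {i} → ¬ Ends H i x y
      no-H-edge-xy e = disjoint (closed₁ _ x y e x∈T₁ (T₂⊆B y∈T₂)) y∈T₂

      noParallel : ¬ ParallelEdges G U
      noParallel (i , i′ , i≢i′ , a , b , a∈U , b∈U , e , e′) with Ends-G e | Ends-G e′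
      ... | inj₁ (refl , _) | inj₁ (refl , _) = i≢i′ refl
      ... | inj₁ (_ , inj₁ (refl , refl)) | inj₂ (_ , f) = no-H-edge-xy f
      ... | inj₁ (_ , inj₂ (refl , refl)) | inj₂ (_ , f) = no-H-edge-xy (Ends-sym {ω = H} f)
      ... | inj₂ (_ , f) | inj₁ (_ , inj₁ (refl , refl)) = no-H-edge-xy f
      ... | inj₂ (_ , f) | inj₁ (_ , inj₂ (refl , refl)) = no-H-edge-xy (Ends-sym {ω = H} f)
      ... | inj₂ (_ , f) | inj₂ (_ , f′) with x∈p∪q⁻ T₁ T₂ a∈U
      ...   | inj₁ a∈T₁ = component-noParallel tree₁
                            (i , i′ , i≢i′ , a , b , a∈T₁ , closed₁ i a b f a∈T₁ (U⊆B b∈U) , f , f′)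
      ...   | inj₂ a∈T₂ = component-noParallel tree₂
                            (i , i′ , i≢i′ , a , b , a∈T₂ , closed₂ i a b f a∈T₂ (U⊆B b∈U) , f , f′)

      WithinH : Subset n → Fin n → List (Fin n) → Set
      WithinH T h zs = h ∈ T → Path H T (h ∷ zs) × lastOf h zs ∈ T

      data Shape (h : Fin n) (zs : List (Fin n)) : Set where
        within : WithinH T₁ h zs → WithinH T₂ h zs → Shape h zs
        crossing : x ∈ₗ h ∷ zs → y ∈ₗ h ∷ zs →
          (h ∈ T₁ → lastOf h zs ∈ T₂) → (h ∈ T₂ → lastOf h zs ∈ T₁) → Shape h zs

      shape : ∀ {h zs} → Unique (h ∷ zs) → Path G U (h ∷ zs) → Shape h zs
      shape _ one = within (λ h∈T₁ → one , h∈T₁) (λ h∈T₂ → one , h∈T₂)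
      shape {h} {b ∷ zs} (h∉ ∷ unique) (cons (h∈U , b∈U , i , e) path) with Ends-G e | shape unique path
      ... | inj₂ (_ , e′) | within w₁ w₂ = within (extend closed₁ w₁) (extend closed₂ w₂)
        where
        extend : ∀ {T} → Closed B H T → WithinH T b zs → WithinH T h (b ∷ zs)
        extend closed w h∈T with w (closed i h b e′ h∈T (U⊆B b∈U))
        ... | p , last∈T = cons (h∈T , closed i h b e′ h∈T (U⊆B b∈U) , i , e′) p , last∈T
      ... | inj₂ (_ , e′) | crossing x∈ y∈ s₁ s₂ =
        crossing (there x∈) (there y∈) (λ h∈T₁ → s₁ (closed₁ i h b e′ h∈T₁ (U⊆B b∈U)))
                                       (λ h∈T₂ → s₂ (closed₂ i h b e′ h∈T₂ (U⊆B b∈U)))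
      ... | inj₁ (_ , inj₁ (refl , refl)) | crossing x∈ _ _ _ = ⊥-elim (All.lookup h∉ x∈ refl)
      ... | inj₁ (_ , inj₂ (refl , refl)) | crossing _ y∈ _ _ = ⊥-elim (All.lookup h∉ y∈ refl)
      ... | inj₁ (_ , inj₁ (refl , refl)) | within _ w₂ =
        crossing (here refl) (there (here refl)) (λ _ → proj₂ (w₂ y∈T₂)) (λ x∈T₂ → ⊥-elim (x∉T₂ x∈T₂))
      ... | inj₁ (_ , inj₂ (refl , refl)) | within w₁ _ =
        crossing (there (here refl)) (here refl) (λ y∈T₁ → ⊥-elim (disjoint y∈T₁ y∈T₂)) (λ _ → proj₂ (w₁ x∈T₁))

      JoinsXY-across : ∀ {a b} → JoinsXY a b → ¬ ((a ∈ T₁ × b ∈ T₁) ⊎ (a ∈ T₂ × b ∈ T₂))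
      JoinsXY-across (inj₁ (refl , refl)) (inj₁ (_ , y∈T₁)) = disjoint y∈T₁ y∈T₂
      JoinsXY-across (inj₁ (refl , refl)) (inj₂ (x∈T₂ , _)) = x∉T₂ x∈T₂
      JoinsXY-across (inj₂ (refl , refl)) (inj₁ (y∈T₁ , _)) = disjoint y∈T₁ y∈T₂
      JoinsXY-across (inj₂ (refl , refl)) (inj₂ (_ , x∈T₂)) = x∉T₂ x∈T₂

      JoinsXY-∈ : ∀ {a b zs} → JoinsXY a b → x ∈ₗ zs → y ∈ₗ zs → b ∈ₗ zs
      JoinsXY-∈ (inj₁ (_ , refl)) _ y∈ = y∈
      JoinsXY-∈ (inj₂ (_ , refl)) x∈ _ = x∈

      JoinsXY-unique : ∀ {a b c} → JoinsXY a b → JoinsXY b c → a ≡ c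
      JoinsXY-unique (inj₁ (refl , refl)) (inj₁ (y≡x , _)) = ⊥-elim (x≢y (sym y≡x))
      JoinsXY-unique (inj₁ (refl , refl)) (inj₂ (_ , refl)) = refl
      JoinsXY-unique (inj₂ (refl , refl)) (inj₁ (_ , refl)) = refl
      JoinsXY-unique (inj₂ (refl , refl)) (inj₂ (x≡y , _)) = ⊥-elim (x≢y x≡y)

      -- Edges of G[U] other than j never leave T₁ or T₂.  So a cycle whose closing edge is not j either
      -- stays on one side, where it is an H-cycle, or crosses by j and cannot come back; and a cycle
      -- closed by j leaves a path without j from one side to the other.
      acyclic : ∀ zs → ¬ Cycle G U zs
      acyclic (c₀ ∷ c₁ ∷ c₂ ∷ zs) (unique , path , (ℓ∈U , c₀∈U , i , e)) with Ends-G e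
      ... | inj₂ (_ , e′) with shape unique path | x∈p∪q⁻ T₁ T₂ c₀∈U
      ...   | within w₁ _ | inj₁ c₀∈T₁ =
        component-acyclic tree₁ _ (unique , proj₁ (w₁ c₀∈T₁) , proj₂ (w₁ c₀∈T₁) , c₀∈T₁ , i , e′)
      ...   | within _ w₂ | inj₂ c₀∈T₂ =
        component-acyclic tree₂ _ (unique , proj₁ (w₂ c₀∈T₂) , proj₂ (w₂ c₀∈T₂) , c₀∈T₂ , i , e′)
      ...   | crossing _ _ s₁ _ | inj₁ c₀∈T₁ = disjoint c₀∈T₁ (closed₂ i _ c₀ e′ (s₁ c₀∈T₁) (U⊆B c₀∈U))
      ...   | crossing _ _ _ s₂ | inj₂ c₀∈T₂ = disjoint (closed₁ i _ c₀ e′ (s₂ c₀∈T₂) (U⊆B c₀∈U)) c₀∈T₂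
      acyclic (c₀ ∷ c₁ ∷ c₂ ∷ zs) ((c₀∉ ∷ c₁∉ ∷ unique) , cons (_ , c₁∈U , i₁ , e₁) path , (_ , c₀∈U , _ , _))
        | inj₁ (_ , ℓc₀) with Ends-G e₁
      ... | inj₁ (_ , c₀c₁) = All.lookup c₁∉ (lastOf-∈ c₂ zs) (sym (JoinsXY-unique ℓc₀ c₀c₁))
      ... | inj₂ (_ , e₁′) with shape (c₁∉ ∷ unique) path | x∈p∪q⁻ T₁ T₂ c₀∈U
      ...   | crossing x∈ y∈ _ _ | _ = All.lookup c₀∉ (JoinsXY-∈ ℓc₀ x∈ y∈) refl
      ...   | within w₁ _ | inj₁ c₀∈T₁ =
        JoinsXY-across ℓc₀ (inj₁ (proj₂ (w₁ (closed₁ i₁ c₀ c₁ e₁′ c₀∈T₁ (U⊆B c₁∈U))) , c₀∈T₁))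
      ...   | within _ w₂ | inj₂ c₀∈T₂ =
        JoinsXY-across ℓc₀ (inj₂ (proj₂ (w₂ (closed₂ i₁ c₀ c₁ e₁′ c₀∈T₂ (U⊆B c₁∈U))) , c₀∈T₂))

      tree : TreeComponent B G U
      tree = ((x , x∈p∪q⁺ (inj₁ x∈T₁)) , connected , noParallel , acyclic) , Closed-∪ closed₁ closed₂ x∈T₁ y∈T₂

-- The effect of deleting an edge on I

module Deletion {m n} (B : Subset n) (k : ℕ) {ind : Seq m n → Subset n → ℚ} (isInd : IsIndicator B ind)
  {G H : Seq m n} {j : Fin m} {v : Fin n}
  (H≗G : ∀ i → i ≢ j → H i ≡ G i) (H-loop : H j ≡ (v , v))
  (loopless : ∀ i → proj₁ (G i) ≢ proj₂ (G i)) where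

  open Weights k
  open EdgeDeletion H≗G H-loop loopless

  I : Seq m n → ℚ
  I = Ifun B d ind

  L : List (Subset n)
  L = filter (admissible? B d) (allSubsets n)

  c : Subset n → ℚ
  c U = weight ∣ U ∣ₛ

  L-unique : Unique L
  L-unique = Unique.filter⁺ (admissible? B d) (allSubsets-unique n)

  ∈L⁺ : ∀ {U} → Admissible B d U → U ∈ₗ L
  ∈L⁺ {U} = ∈-filter⁺ (admissible? B d) (∈-allSubsets U)

  ∈L⁻ : ∀ {U} → U ∈ₗ L → Admissible B d U
  ∈L⁻ U∈L = proj₂ (∈-filter⁻ (admissible? B d) {xs = allSubsets n} U∈L)

  ⊆B : ∀ {U} → U ∈ₗ L → U ⊆ B
  ⊆B U∈L = proj₁ (∈L⁻ U∈L)

  Bounded : ℚ → Set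
  Bounded q = 0ℚ ≤ℚ q × q ≤ℚ 1ℚ + ε

  Σc : ∀ {P : Subset n → Set} → (∀ U → Dec (P U)) → ℚ
  Σc P? = sumℚ (map (λ U → select (P? U) (c U)) L)

  c-bounded : ∀ {U} → U ∈ₗ L → Bounded (c U)
  c-bounded {U} U∈L = weight-nonneg (proj₂ (proj₂ (∈L⁻ U∈L))) , weight≤1+ε ∣ U ∣ₛ

  TreeComponent? : ∀ K U → Dec (TreeComponent B K U)
  TreeComponent? K U with isInd K U
  ... | inj₁ (tc , _) = yes tc
  ... | inj₂ (¬tc , _) = no ¬tc

  I≡Σc : ∀ K → I K ≡ Σc (TreeComponent? K)
  I≡Σc K = sumℚ-cong L (λ {U} _ → weighted-indicator U)
    where
    weighted-indicator : ∀ U → c U * ind K U ≡ select (TreeComponent? K U) (c U)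
    weighted-indicator U with isInd K U
    ... | inj₁ (_ , ind≡1) = trans (cong (c U *_) ind≡1) (ℚ.*-identityʳ (c U))
    ... | inj₂ (_ , ind≡0) = trans (cong (c U *_) ind≡0) (ℚ.*-zeroʳ (c U))

  ∉⇒Avoids : ∀ {U} → x ∉ U → y ∉ U → Avoids {B = B} U
  ∉⇒Avoids x∉U y∉U = (λ (x∈U , _) → x∉U x∈U) , (λ (y∈U , _) → y∉U y∈U)

  unaffected : ¬ (x ∈ B × y ∈ B) → I H ≡ I G
  unaffected ¬xy∈B = trans (I≡Σc H) (trans (sumℚ-cong L same) (sym (I≡Σc G)))
    where
    avoids : ∀ {U} → U ⊆ B → Avoids {B = B} U
    avoids U⊆B = (λ (x∈U , y∈B) → ¬xy∈B (U⊆B x∈U , y∈B)) , (λ (y∈U , x∈B) → ¬xy∈B (x∈B , U⊆B y∈U))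
    same : ∀ {U} → U ∈ₗ L → select (TreeComponent? H U) (c U) ≡ select (TreeComponent? G U) (c U)
    same {U} U∈L with TreeComponent? H U | TreeComponent? G U
    ... | yes _ | yes _ = refl
    ... | no _ | no _ = refl
    ... | yes tH | no ¬tG = ⊥-elim (¬tG (TreeComponent-H⇒G (⊆B U∈L) (avoids (⊆B U∈L)) tH))
    ... | no ¬tH | yes tG = ⊥-elim (¬tH (TreeComponent-G⇒H (⊆B U∈L) (avoids (⊆B U∈L)) tG))

  Px Py PG : Subset n → Set
  Px U = TreeComponent B H U × x ∈ U
  Py U = TreeComponent B H U × y ∈ U × x ∉ U
  PG U = TreeComponent B G U × (x ∈ U ⊎ y ∈ U)

  Px? : ∀ U → Dec (Px U)
  Px? U = TreeComponent? H U ×-dec x ∈? U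

  Py? : ∀ U → Dec (Py U)
  Py? U = TreeComponent? H U ×-dec (y ∈? U ×-dec ¬? (x ∈? U))

  PG? : ∀ U → Dec (PG U)
  PG? U = TreeComponent? G U ×-dec (x ∈? U ⊎-dec y ∈? U)

  difference≡ : I H - I G ≡ Σc Px? + Σc Py? - Σc PG?
  difference≡ = begin
    I H - I G
      ≡⟨ cong₂ _-_ (I≡Σc H) (I≡Σc G) ⟩
    Σc (TreeComponent? H) - Σc (TreeComponent? G)
      ≡⟨ sym (sumℚ-map-- _ _ L) ⟩
    sumℚ (map (λ U → select (TreeComponent? H U) (c U) - select (TreeComponent? G U) (c U)) L)
      ≡⟨ sumℚ-cong L pointwise ⟩
    sumℚ (map (λ U → select (Px? U) (c U) + select (Py? U) (c U) - select (PG? U) (c U)) L)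
      ≡⟨ sumℚ-map-- _ _ L ⟩
    sumℚ (map (λ U → select (Px? U) (c U) + select (Py? U) (c U)) L) - Σc PG?
      ≡⟨ cong (_- Σc PG?) (sumℚ-map-+ _ _ L) ⟩
    Σc Px? + Σc Py? - Σc PG? ∎
    where
    open ≡-Reasoning
    pointwise : ∀ {U} → U ∈ₗ L →
      select (TreeComponent? H U) (c U) - select (TreeComponent? G U) (c U) ≡
      select (Px? U) (c U) + select (Py? U) (c U) - select (PG? U) (c U)
    pointwise {U} U∈L = select-split (TreeComponent? H U) (TreeComponent? G U) (x ∈? U) (y ∈? U) (c U)
      (λ x∉U y∉U → TreeComponent-H⇒G (⊆B U∈L) (∉⇒Avoids x∉U y∉U))
      (λ x∉U y∉U → TreeComponent-G⇒H (⊆B U∈L) (∉⇒Avoids x∉U y∉U))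

  module BothInB (x∈B : x ∈ B) (y∈B : y ∈ B) where

    unique-through : ∀ {K : Seq m n} (z : Fin n) {P : Subset n → Set} →
      (∀ {U} → P U → TreeComponent B K U × z ∈ U) → ∀ {U U′} → U ∈ₗ L → U′ ∈ₗ L → P U → P U′ → U ≡ U′
    unique-through z through U∈L U′∈L pU pU′ with through pU | through pU′
    ... | tU , z∈U | tU′ , z∈U′ = TreeComponent-unique tU (⊆B U∈L) tU′ (⊆B U′∈L) z∈U z∈U′

    G-through-x : ∀ {T} → PG T → TreeComponent B G T × x ∈ T
    G-through-x (tree , x∨y∈T) = tree , proj₁ (Closed-∋x⇔∋y x∈B y∈B (proj₂ tree) x∨y∈T)

    bounds : ∀ {sx sy sg} → Selection L Px c sx → Selection L Py c sy → Selection L PG c sg →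
      Bounded (sx + sy - sg)
    bounds (none _) (none _) (none _) = ℚ.≤-refl , 0≤1+ε
    bounds (just T₁∈L _) (none _) (none _) =
      subst Bounded (sym (trans (ℚ.+-identityʳ _) (ℚ.+-identityʳ _))) (c-bounded T₁∈L)
    bounds (none _) (just T₂∈L _) (none _) =
      subst Bounded (sym (trans (ℚ.+-identityʳ _) (ℚ.+-identityˡ _))) (c-bounded T₂∈L)
    bounds (just {T₁} T₁∈L (tree₁ , x∈T₁)) (just {T₂} T₂∈L (tree₂ , y∈T₂ , x∉T₂)) (none ¬PG) =
      subst Bounded (sym (ℚ.+-identityʳ _))
        (ℚ.+-mono-≤ (proj₁ (c-bounded T₁∈L)) (proj₁ (c-bounded T₂∈L)) ,
         weight-+-large (x∈p⇒0<∣p∣ x∈T₁) (x∈p⇒0<∣p∣ y∈T₂) d≤∣T₁∣+∣T₂∣)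
      where
      open Merge tree₁ tree₂ (⊆B T₁∈L) (⊆B T₂∈L) x∈T₁ y∈T₂ x∉T₂
      x∈U : x ∈ U
      x∈U = x∈p∪q⁺ (inj₁ x∈T₁)
      -- otherwise T₁ ∪ T₂ would be an admissible tree component of G through x
      d≤∣T₁∣+∣T₂∣ : d ≤ ∣ T₁ ∣ₛ +ₙ ∣ T₂ ∣ₛ
      d≤∣T₁∣+∣T₂∣ = ℕ.<⇒≤ (ℕ.≰⇒> λ ∣T₁∣+∣T₂∣≤d →
        ¬PG (∈L⁺ (U⊆B , x∈p⇒0<∣p∣ x∈U , subst (_≤ d) (sym (∣p∪q∣≡∣p∣+∣q∣ T₁ T₂ disjoint)) ∣T₁∣+∣T₂∣≤d))
            (tree , inj₁ x∈U))
    bounds (none ¬Px) _ (just T∈L PT) with G-through-x PT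
    ... | treeT , x∈T = ⊥-elim (H-component-at-x treeT (⊆B T∈L) x∈T λ (T₁ , tree₁ , T₁⊆T , x∈T₁) →
      ¬Px (∈L⁺ ((λ z∈T₁ → ⊆B T∈L (T₁⊆T z∈T₁)) , x∈p⇒0<∣p∣ x∈T₁ ,
                 ℕ.≤-trans (p⊆q⇒∣p∣≤∣q∣ T₁⊆T) (proj₂ (proj₂ (∈L⁻ T∈L)))))
          (tree₁ , x∈T₁))
    bounds (just {T₁} T₁∈L (tree₁ , x∈T₁)) (none _) (just {T} T∈L PT) with G-through-x PT
    ... | treeT , x∈T = subst Bounded (sym (cong (_- c T) (ℚ.+-identityʳ (c T₁))))
      (weight-antitone (p⊆q⇒∣p∣≤∣q∣ T₁⊆T) (proj₂ (proj₂ (∈L⁻ T∈L))))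
      where
      T₁⊆T : T₁ ⊆ T
      T₁⊆T = H-component⊆G-component tree₁ (⊆B T₁∈L) (proj₂ treeT) x∈T₁ x∈T
    bounds (just {T₁} T₁∈L (tree₁ , x∈T₁)) (just {T₂} T₂∈L (tree₂ , y∈T₂ , x∉T₂)) (just {T} T∈L PT)
      with G-through-x PT
    ... | treeT , x∈T = subst Bounded (sym split) (0≤1+ε , ℚ.≤-refl)
      where
      open Merge tree₁ tree₂ (⊆B T₁∈L) (⊆B T₂∈L) x∈T₁ y∈T₂ x∉T₂
      ∣T∣≡∣T₁∣+∣T₂∣ : ∣ T ∣ₛ ≡ ∣ T₁ ∣ₛ +ₙ ∣ T₂ ∣ₛ
      ∣T∣≡∣T₁∣+∣T₂∣ = trans
        (cong ∣_∣ₛ (TreeComponent-unique treeT (⊆B T∈L) tree U⊆B x∈T (x∈p∪q⁺ (inj₁ x∈T₁))))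
        (∣p∪q∣≡∣p∣+∣q∣ T₁ T₂ disjoint)
      split : c T₁ + c T₂ - c T ≡ 1ℚ + ε
      split = trans (cong (λ t → c T₁ + c T₂ - weight t) ∣T∣≡∣T₁∣+∣T₂∣)
                    (weight-split (x∈p⇒0<∣p∣ x∈T₁) (x∈p⇒0<∣p∣ y∈T₂))

  deletion-bounded : Bounded (I H - I G)
  deletion-bounded with x ∈? B ×-dec y ∈? B
  ... | yes (x∈B , y∈B) = subst Bounded (sym difference≡)
    (bounds (selection Px? c L-unique (unique-through x id))
            (selection Py? c L-unique (unique-through y (λ (t , y∈U , _) → t , y∈U)))
            (selection PG? c L-unique (unique-through x G-through-x)))
    where open BothInB x∈B y∈B
  ... | no ¬xy∈B = subst Bounded (sym (trans (cong (_- I G) (unaffected ¬xy∈B)) (ℚ.+-inverseʳ (I G))))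
                         (ℚ.≤-refl , 0≤1+ε)

lemma8 : (n m d : ℕ) → 2 ≤ d → (S A B : Subset n)
    → (∀ x → x ∈ S → x ∈ A → ⊥) → (∀ x → x ∈ S → x ∈ B → ⊥) → (∀ x → x ∈ A → x ∈ B → ⊥)
    → (∀ x → x ∈ S ⊎ x ∈ A ⊎ x ∈ B)
    → (ind : Seq m n → Subset n → ℚ) → IsIndicator B ind
    → (ω ω′ : Seq m n) → (∀ i → InEW A B (ω i)) → (∀ i → InEW A B (ω′ i))
    → Σ (Fin m) (λ j → ¬ (ω j ≡ ω′ j) × (∀ i → ¬ (i ≡ j) → ω i ≡ ω′ i))
    → ∣ Ifun B d ind ω - Ifun B d ind ω′ ∣ ≤ℚ (1ℚ + eps d)
lemma8 n m d@(suc (suc k)) (s≤s (s≤s z≤n)) S A B _ _ _ _ ind isInd ω ω′ ω∈EW ω′∈EW (j , _ , ω≗ω′) =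
  ∣p-q∣≤r {h = I H} (proj₁ from-ω) (proj₂ from-ω) (proj₁ from-ω′) (proj₂ from-ω′)
  where
  I : Seq m n → ℚ
  I = Ifun B d ind
  v : Fin n
  v = proj₁ (ω j)
  -- H is ω, and also ω′, with edge j deleted
  H : Seq m n
  H = updateAt ω j (λ _ → v , v)
  H≗ω : ∀ i → i ≢ j → H i ≡ ω i
  H≗ω i i≢j = updateAt-minimal i j ω i≢j
  H≗ω′ : ∀ i → i ≢ j → H i ≡ ω′ i
  H≗ω′ i i≢j = trans (H≗ω i i≢j) (ω≗ω′ i i≢j)
  from-ω : 0ℚ ≤ℚ I H - I ω × I H - I ω ≤ℚ 1ℚ + eps d
  from-ω = Deletion.deletion-bounded B k isInd H≗ω (updateAt-updates j ω) (λ i → <⇒≢ (proj₁ (ω∈EW i)))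
  from-ω′ : 0ℚ ≤ℚ I H - I ω′ × I H - I ω′ ≤ℚ 1ℚ + eps d
  from-ω′ = Deletion.deletion-bounded B k isInd H≗ω′ (updateAt-updates j ω) (λ i → <⇒≢ (proj₁ (ω′∈EW i)))
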